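{- Let $G=(V,E)$ be a finite graph with no isolated vertices and $m\ge1$ an integer. Define $f(A)=\sum_{v\in V}m_A(v)$ where $m_A(v)=m$ if [$v\notin A$ and $|N_A(v)|\ge m$] or [$v\in A$ and $|N_A(v)|>0$]; $m_A(v)=m-1$ if $v\in A$ and $|N_A(v)|=0$; and $m_A(v)=|N_A(v)|$ otherwise. Then $S\subseteq V$ is a fault-tolerant total dominating set if and only if $f(S)=\max_{X\subseteq V}f(X)$.
   Context: $N_A(v)=N(v)\cap A$. A set $S\subseteq V$ is a fault-tolerant total dominating set (with parameter $m$) if every vertex of $V\setminus S$ has at least $m$ neighbors in $S$ and every vertex of $S$ has at least one neighbor in $S$. -}

module Defs where

open import Data.Nat using (ℕ; zero; suc; _∸_; _≤_; _≤ᵇ_; _+_)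
open import Data.Bool using (Bool; true; false; if_then_else_)
open import Data.Fin using (Fin)
open import Data.Fin.Subset using (Subset; _∈_; _∉_; _∩_; ∣_∣)
open import Data.Vec using (lookup; tabulate)
open import Data.List using (map; allFin)
open import Data.Nat.ListAction using (sum)
open import Data.Product using (∃; _×_)
open import Relation.Binary.PropositionalEquality using (_≡_)

record Graph (n : ℕ) : Set where
  field
    adj       : Fin n → Fin n → Bool
    adj-sym   : ∀ u v → adj u v ≡ adj v u
    adj-irrefl : ∀ v → adj v v ≡ false

open Graph public

N : ∀ {n} → Graph n → Fin n → Subset n
N G v = tabulate (λ u → adj G v u)

degIn : ∀ {n} → Graph n → Subset n → Fin n → ℕ
degIn G A v = ∣ N G v ∩ A ∣

NoIsolated : ∀ {n} → Graph n → Set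
NoIsolated G = ∀ v → ∃ λ u → adj G v u ≡ true

FTTDS : ∀ {n} → Graph n → ℕ → Subset n → Set
FTTDS G m S = (∀ v → v ∉ S → m ≤ degIn G S v) × (∀ v → v ∈ S → 1 ≤ degIn G S v)

mA' : ℕ → Bool → ℕ → ℕ
mA' m true  zero    = m ∸ 1
mA' m true  (suc _) = m
mA' m false k       = if m ≤ᵇ k then m else k

mA : ∀ {n} → Graph n → ℕ → Subset n → Fin n → ℕ
mA G m A v = mA' m (lookup A v) (degIn G A v)

f : ∀ {n} → Graph n → ℕ → Subset n → ℕ
f {n} G m A = sum (map (mA G m A) (allFin n))

-- Every m_A(v) is at most m, and m_A(v) = m says precisely that v meets its
-- fault-tolerant total domination requirement in A.  Without isolated vertices
-- A = V meets every requirement, so max f = m|V|, attained exactly by the sets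
-- meeting all requirements, i.e. by the fault-tolerant total dominating sets.
module Submission where

open import Defs
open import Data.Bool using (Bool; true; false)
open import Data.Empty using (⊥-elim)
open import Data.Fin using (Fin)
open import Data.Fin.Subset using (Subset; _∈_; _∉_; ∣_∣; ⊤)
open import Data.Fin.Subset.Properties using (∣p∣≤∣x∷p∣; ∩-identityʳ)
open import Data.List using (List; []; _∷_; map; allFin)
open import Data.List.Membership.Propositional using () renaming (_∈_ to _∈ₗ_)
open import Data.List.Membership.Propositional.Properties using (∈-allFin)
open import Data.List.Relation.Unary.Any using (here; there)
open import Data.Nat using (ℕ; zero; suc; _+_; _≤_; _≤ᵇ_; z≤n; s≤s)
open import Data.Nat.ListAction using (sum)
open import Data.Nat.Properties
open import Data.Product using (_×_; _,_; proj₁; proj₂)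
open import Data.Vec using (lookup; _∷_; here; there)
open import Data.Vec.Properties using ([]=⇒lookup; lookup⇒[]=; lookup∘tabulate; lookup-replicate)
open import Function.Bundles using (_⇔_; mk⇔; Equivalence)
open import Function.Properties.Equivalence using (⇔-setoid) renaming (sym to ⇔-sym)
open import Level using (0ℓ)
import Relation.Binary.Reasoning.Setoid as SetoidReasoning
open import Relation.Binary.PropositionalEquality
open import Relation.Nullary using (contradiction)
open import Relation.Nullary.Reflects using (ofʸ; ofⁿ)

sum-map-mono-≤ : ∀ {A : Set} {g h : A → ℕ} → (∀ x → g x ≤ h x) → (xs : List A) →
                 sum (map g xs) ≤ sum (map h xs)
sum-map-mono-≤ g≤h []       = z≤n
sum-map-mono-≤ g≤h (x ∷ xs) = +-mono-≤ (g≤h x) (sum-map-mono-≤ g≤h xs)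

+-mono-≤-equality : ∀ {a b c d} → a ≤ b → c ≤ d → b + d ≤ a + c → a ≡ b × c ≡ d
+-mono-≤-equality {a} {b} {c} {d} a≤b c≤d bd≤ac =
    ≤-antisym a≤b (+-cancelʳ-≤ d b a (≤-trans bd≤ac (+-monoʳ-≤ a c≤d)))
  , ≤-antisym c≤d (+-cancelˡ-≤ b d c (≤-trans bd≤ac (+-monoˡ-≤ c a≤b)))

sum-map-mono-≤-equality : ∀ {A : Set} {g h : A → ℕ} → (∀ x → g x ≤ h x) → (xs : List A) →
                          sum (map h xs) ≤ sum (map g xs) → ∀ {y} → y ∈ₗ xs → g y ≡ h y
sum-map-mono-≤-equality g≤h (x ∷ xs) hs≤gs (here refl) =
  proj₁ (+-mono-≤-equality (g≤h x) (sum-map-mono-≤ g≤h xs) hs≤gs)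
sum-map-mono-≤-equality g≤h (x ∷ xs) hs≤gs (there y∈xs) =
  sum-map-mono-≤-equality g≤h xs
    (≤-reflexive (sym (proj₂ (+-mono-≤-equality (g≤h x) (sum-map-mono-≤ g≤h xs) hs≤gs)))) y∈xs

x∈p⇒1≤∣p∣ : ∀ {n} {x : Fin n} {p : Subset n} → x ∈ p → 1 ≤ ∣ p ∣
x∈p⇒1≤∣p∣ here                   = s≤s z≤n
x∈p⇒1≤∣p∣ {p = y ∷ p} (there x∈p) = ≤-trans (x∈p⇒1≤∣p∣ x∈p) (∣p∣≤∣x∷p∣ y p)

required : ℕ → Bool → ℕ
required m true  = 1
required m false = m

mA'-≤ : ∀ m b k → mA' m b k ≤ m
mA'-≤ m true  zero    = m∸n≤m m 1
mA'-≤ m true  (suc k) = ≤-refl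
mA'-≤ m false k with m ≤ᵇ k | ≤ᵇ-reflects-≤ m k
... | true  | _       = ≤-refl
... | false | ofⁿ m≰k = ≰⇒≥ m≰k

mA'≡m⇔required≤ : ∀ {m} → 1 ≤ m → ∀ b k → mA' m b k ≡ m ⇔ required m b ≤ k
mA'≡m⇔required≤ {suc m} _ true zero    = mk⇔ (λ m≡1+m → ⊥-elim (1+n≢n (sym m≡1+m))) (λ ())
mA'≡m⇔required≤ {m}     _ true (suc k) = mk⇔ (λ _ → s≤s z≤n) (λ _ → refl)
mA'≡m⇔required≤ {m}     _ false k with m ≤ᵇ k | ≤ᵇ-reflects-≤ m k
... | true  | ofʸ m≤k = mk⇔ (λ _ → m≤k) (λ _ → refl)
... | false | ofⁿ m≰k = mk⇔ (λ k≡m → ≤-reflexive (sym k≡m)) (λ m≤k → ⊥-elim (m≰k m≤k))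

module _ {n} (G : Graph n) (m : ℕ) where

  MeetsRequirements : Subset n → Set
  MeetsRequirements A = ∀ v → required m (lookup A v) ≤ degIn G A v

  Saturates : Subset n → Set
  Saturates A = ∀ v → mA G m A v ≡ m

  Maximises-f : Subset n → Set
  Maximises-f S = ∀ X → f G m X ≤ f G m S

  mA-≤ : ∀ A v → mA G m A v ≤ m
  mA-≤ A v = mA'-≤ m (lookup A v) (degIn G A v)

  FTTDS⇔MeetsRequirements : ∀ S → FTTDS G m S ⇔ MeetsRequirements S
  FTTDS⇔MeetsRequirements S = mk⇔ to from
    where
    to : FTTDS G m S → MeetsRequirements S
    to (outside-ok , inside-ok) v with lookup S v in v∈?S
    ... | true  = inside-ok v (lookup⇒[]= v S v∈?S)
    ... | false = outside-ok v λ v∈S → contradiction (trans (sym v∈?S) ([]=⇒lookup v∈S)) λ ()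

    from : MeetsRequirements S → FTTDS G m S
    from meets = outside , inside
      where
      outside : ∀ v → v ∉ S → m ≤ degIn G S v
      outside v v∉S with lookup S v in v∈?S | meets v
      ... | true  | _     = contradiction (lookup⇒[]= v S v∈?S) v∉S
      ... | false | m≤deg = m≤deg
      inside : ∀ v → v ∈ S → 1 ≤ degIn G S v
      inside v v∈S with meets v
      ... | 1≤deg rewrite []=⇒lookup v∈S = 1≤deg

  Saturates⇔MeetsRequirements : 1 ≤ m → ∀ A → Saturates A ⇔ MeetsRequirements A
  Saturates⇔MeetsRequirements 1≤m A = mk⇔
    (λ sat v → Equivalence.to   (mA'≡m⇔required≤ 1≤m (lookup A v) (degIn G A v)) (sat v))
    (λ meets v → Equivalence.from (mA'≡m⇔required≤ 1≤m (lookup A v) (degIn G A v)) (meets v))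

  ⊤-meetsRequirements : NoIsolated G → MeetsRequirements ⊤
  ⊤-meetsRequirements no-isolated v with no-isolated v
  ... | u , v~u rewrite lookup-replicate v true | ∩-identityʳ (N G v) = x∈p⇒1≤∣p∣ u∈N[v]
    where
    u∈N[v] : u ∈ N G v
    u∈N[v] = lookup⇒[]= u (N G v) (trans (lookup∘tabulate (adj G v) u) v~u)

  Saturates⇒Maximises-f : ∀ S → Saturates S → Maximises-f S
  Saturates⇒Maximises-f S sat X =
    sum-map-mono-≤ (λ v → ≤-trans (mA-≤ X v) (≤-reflexive (sym (sat v)))) (allFin n)

  -- Compare S with ⊤: f ⊤ ≤ f S while m_S ≤ m_⊤ = m pointwise forces equality everywhere.
  Maximises-f⇒Saturates : 1 ≤ m → NoIsolated G → ∀ S → Maximises-f S → Saturates S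
  Maximises-f⇒Saturates 1≤m no-isolated S max v =
    trans (sum-map-mono-≤-equality mS≤m⊤ (allFin n) (max ⊤) (∈-allFin v)) (⊤-sat v)
    where
    ⊤-sat : Saturates ⊤
    ⊤-sat = Equivalence.from (Saturates⇔MeetsRequirements 1≤m ⊤) (⊤-meetsRequirements no-isolated)
    mS≤m⊤ : ∀ w → mA G m S w ≤ mA G m ⊤ w
    mS≤m⊤ w = ≤-trans (mA-≤ S w) (≤-reflexive (sym (⊤-sat w)))

  Saturates⇔Maximises-f : 1 ≤ m → NoIsolated G → ∀ S → Saturates S ⇔ Maximises-f S
  Saturates⇔Maximises-f 1≤m no-isolated S =
    mk⇔ (Saturates⇒Maximises-f S) (Maximises-f⇒Saturates 1≤m no-isolated S)

lemma8 : ∀ {n} (G : Graph n) → NoIsolated G → (m : ℕ) → 1 ≤ m → (S : Subset n) →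
         FTTDS G m S ⇔ (∀ (X : Subset n) → f G m X ≤ f G m S)
lemma8 G no-isolated m 1≤m S = begin
  FTTDS G m S                ≈⟨ FTTDS⇔MeetsRequirements G m S ⟩
  MeetsRequirements G m S    ≈⟨ ⇔-sym (Saturates⇔MeetsRequirements G m 1≤m S) ⟩
  Saturates G m S            ≈⟨ Saturates⇔Maximises-f G m 1≤m no-isolated S ⟩
  Maximises-f G m S          ∎
  where open SetoidReasoning (⇔-setoid 0ℓ)
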